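{- Let $F$ be a face of $V_O$, let $\mathcal U_F=\{\lambda\in\Xi_1: F\subseteq\mathrm H_\lambda\}$ and $\phi(F)=\bigcup_{\lambda\in\mathcal U_F}\mathrm{supp}(\lambda)\subseteq\mathbb E$. Then for every $\lambda\in\Xi_1$: $\lambda\in\mathcal U_F$ if and only if $\mathrm{supp}(\lambda)\subseteq\phi(F)$.
   Context: Let $G=(V,E)$ be a finite connected graph, possibly with parallel edges and loops. $\mathbb E$ is the set of oriented edges (two opposite orientations per edge), $\bar e$ the reverse of $e$. A real (resp. integer) flow is $x:\mathbb E\to\mathbb R$ (resp. $\mathbb Z$) with $x_{\bar e}=-x_e$ and $\sum_{e:\,\mathrm{tail}(e)=v}x_e=0$ for all vertices $v$. $\mathrm H$ is the space of real flows, $\Lambda\subset \mathrm H$ the lattice of integer flows, $\langle x,y\rangle=\sum_{\text{edges}}x_ey_e$ (one orientation chosen per edge), $q(x)=\langle x,x\rangle$; $V_O=\{x\in\mathrm H:q(x)\le q(x-\mu)\ \forall\mu\in\Lambda\}$ is the Voronoi cell of the origin (a polytope). For a flow $x$, $\mathrm{supp}(x)=\{e\in\mathbb E:x_e>0\}$. $\Xi_1$ is the set of flows $x^C$ where $C$ is a circuit (an orientation of a cycle of $G$ as a directed cycle) and $x^C_e=1$ if $e\in C$, $-1$ if $\bar e\in C$, $0$ otherwise. For $\lambda\in\Xi_1$, $\mathrm H_\lambda=\{x\in\mathrm H:2\langle x,\lambda\rangle=q(\lambda)\}$.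
   Formalization: Flows in H take rational values instead of real ones, so the Voronoi cell $V_O$ and its faces consist of rational points, each face cut out by a hyperplane with rational coefficients. -}

module Defs where

open import Data.Nat as ℕ using (ℕ; suc)
open import Data.Fin as Fin using (Fin; zero; suc; inject₁; fromℕ; _≟_)
open import Data.Bool using (Bool; true; false; if_then_else_)
open import Data.Product using (Σ; ∃; _×_; _,_; proj₁; proj₂)
open import Data.List using (List; []; _∷_; map; foldr; concatMap)
open import Data.List.Base using (allFin)
open import Data.Integer as ℤ using (ℤ)
open import Data.Rational using (ℚ; 0ℚ; 1ℚ; _+_; _*_; _-_; -_; _≤_; _<_; _/_)
open import Relation.Binary.PropositionalEquality using (_≡_)
open import Relation.Binary.Construct.Closure.ReflexiveTransitive using (Star)
open import Relation.Nullary.Decidable using (⌊_⌋)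
open import Data.Sum using (_⊎_)
open import Function.Definitions using (Injective)

-- A finite multigraph (parallel edges and loops allowed): vertices Fin nV,
-- edges Fin nE, each edge e with a reference orientation src e → tgt e.
record Graph : Set where
  field
    nV  : ℕ
    nE  : ℕ
    src : Fin nE → Fin nV
    tgt : Fin nE → Fin nV

module _ (G : Graph) where
  open Graph G

  Adj : Fin nV → Fin nV → Set
  Adj u v = ∃ λ e → (src e ≡ u × tgt e ≡ v) ⊎ (src e ≡ v × tgt e ≡ u)

  Connected : Set
  Connected = (1 ℕ.≤ nV) × (∀ u v → Star Adj u v)

  -- oriented edges: (e , true) is the reference orientation, (e , false) its reverse
  OEdge : Set
  OEdge = Fin nE × Bool

  rev : OEdge → OEdge
  rev (e , true)  = e , false
  rev (e , false) = e , true

  tail : OEdge → Fin nV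
  tail (e , true)  = src e
  tail (e , false) = tgt e

  head : OEdge → Fin nV
  head (e , true)  = tgt e
  head (e , false) = src e

  allOEdges : List OEdge
  allOEdges = concatMap (λ e → (e , true) ∷ (e , false) ∷ []) (allFin nE)

  -- A function on oriented edges with x_{ē} = - x_e is determined by its
  -- values on reference orientations: x : Fin nE → ℚ.
  Vect : Set
  Vect = Fin nE → ℚ

  val : Vect → OEdge → ℚ
  val x (e , true)  = x e
  val x (e , false) = - x e

  sumℚ : List ℚ → ℚ
  sumℚ = foldr _+_ 0ℚ

  IsFlow : Vect → Set
  IsFlow x = ∀ v → sumℚ (map (λ o → if ⌊ tail o ≟ v ⌋ then val x o else 0ℚ) allOEdges) ≡ 0ℚ

  IsIntegral : Vect → Set
  IsIntegral x = ∀ e → ∃ λ (z : ℤ) → x e ≡ z / 1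

  InΛ : Vect → Set
  InΛ μ = IsFlow μ × IsIntegral μ

  ⟨_,_⟩ : Vect → Vect → ℚ
  ⟨ x , y ⟩ = sumℚ (map (λ e → x e * y e) (allFin nE))

  q : Vect → ℚ
  q x = ⟨ x , x ⟩

  _−ᵥ_ : Vect → Vect → Vect
  (x −ᵥ y) e = x e - y e

  InVO : Vect → Set
  InVO x = IsFlow x × (∀ μ → InΛ μ → q x ≤ q (x −ᵥ μ))

  -- Faces of V_O: intersections of V_O with a supporting (weak) half-space
  -- boundary {⟨a,y⟩ = b} where ⟨a,y⟩ ≤ b on V_O (includes ∅ and V_O itself).
  IsFace : (Vect → Set) → Set
  IsFace F = Σ Vect λ a → Σ ℚ λ b →
               (∀ y → InVO y → ⟨ a , y ⟩ ≤ b) ×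
               (∀ y → (F y → InVO y × ⟨ a , y ⟩ ≡ b) × (InVO y × ⟨ a , y ⟩ ≡ b → F y))

  -- A circuit: oriented edges o₀ … o_k (length k+1 ≥ 1) forming a directed
  -- closed walk (head oᵢ = tail oᵢ₊₁ cyclically) through distinct vertices
  -- and distinct underlying edges, i.e. an orientation of a cycle of G.
  record Circuit : Set where
    field
      k      : ℕ
      es     : Fin (suc k) → OEdge
      linked : ∀ (i : Fin k) → head (es (inject₁ i)) ≡ tail (es (suc i))
      closes : head (es (fromℕ k)) ≡ tail (es zero)
      edgesDistinct : Injective _≡_ _≡_ (λ i → proj₁ (es i))
      tailsDistinct : Injective _≡_ _≡_ (λ i → tail (es i))

  allIdx : (k : ℕ) → List (Fin (suc k))
  allIdx k = allFin (suc k)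

  xC : Circuit → Vect
  xC C e = sumℚ (map contrib (allIdx (Circuit.k C)))
    where
    contrib : Fin (suc (Circuit.k C)) → ℚ
    contrib i with Circuit.es C i
    ... | (f , d) = if ⌊ f ≟ e ⌋ then (if d then 1ℚ else - 1ℚ) else 0ℚ

  InSupp : Vect → OEdge → Set
  InSupp x o = 0ℚ < val x o

  InH : Vect → Vect → Set
  InH l x = (1ℚ + 1ℚ) * ⟨ x , l ⟩ ≡ q l

  SubH : (Vect → Set) → Vect → Set
  SubH F l = ∀ x → F x → InH l x

  InU : (Vect → Set) → Circuit → Set
  InU F C = SubH F (xC C)

  Inφ : (Vect → Set) → OEdge → Set
  Inφ F o = Σ Circuit λ D → InU F D × InSupp (xC D) o

-- Only "⇐" has content. Fix x ∈ F ⊆ V_O and give each oriented edge the slack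
-- s(o) = 1 − 2 x_o. Every closed walk has nonnegative total slack: if it never
-- revisits a vertex nor traverses an edge back, its edges are distinct, so
-- its chain μ is an integer flow with q(μ) = length, and the slack equals
-- q(μ) − 2⟨x,μ⟩ = q(x − μ) − q(x) ≥ 0; otherwise it splits into shorter closed
-- walks, plus possibly a pair o, ō of total slack 2. For a circuit C, x lies
-- on H_{x^C} exactly when C has slack 0. If supp(x^C) ⊆ φ(F), every o ∈ C lies
-- on a circuit of slack 0, whose remaining edges return from head o to tail o
-- with slack −s(o); running these return paths along C backwards gives a
-- closed walk of slack −(slack of C). Both slacks are ≥ 0, so C has slack 0.
module Submission where

open import Defs
open import Function.Bundles using (_⇔_; mk⇔; Equivalence)

open import Data.Bool using (Bool; true; false; if_then_else_)
import Data.Bool.Properties as Bool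
open import Data.Empty using (⊥-elim)
open import Data.Fin using (Fin; zero; suc; _≟_)
import Data.Integer.Base as ℤ
open import Data.List using (List; []; _∷_; map; foldr; _++_; tabulate; length; concatMap)
open import Data.List.Base using (allFin)
open import Data.List.Membership.Propositional using (_∈_; find)
open import Data.List.Membership.Propositional.Properties using (∈-∃++)
open import Data.List.Properties using (map-tabulate; map-∘; length-++-≤ˡ; length-++-≤ʳ; length-++-sucʳ)
open import Data.List.Relation.Unary.All as All using (All; []; _∷_)
open import Data.List.Relation.Unary.All.Properties using (¬Any⇒All¬)
open import Data.List.Relation.Unary.Any using (here; there; any?)
open import Data.List.Relation.Unary.AllPairs as AllPairs using (AllPairs; []; _∷_)
import Data.List.Relation.Unary.AllPairs.Properties as AllPairs
open import Data.Nat as ℕ using (s≤s)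
open import Data.Nat.Induction using (<-wellFounded)
import Data.Nat.Properties as ℕₚ
open import Data.Product using (Σ-syntax; ∃; _×_; _,_; proj₁; proj₂)
open import Data.Product.Properties using (≡-dec)
open import Data.Rational using (ℚ; 0ℚ; 1ℚ; _+_; _*_; _-_; -_; _≤_; _<_; _/_)
import Data.Rational.Properties as ℚ
open import Data.Rational.Solver using (module +-*-Solver)
open import Data.Sum using (_⊎_; inj₁; inj₂)
open import Function using (id; _∘_)
open import Induction.WellFounded using (Acc; acc)
open import Relation.Binary.PropositionalEquality
open import Relation.Nullary using (¬_; Dec; yes; no)
open import Relation.Nullary.Decidable using (⌊_⌋)

open +-*-Solver

2ℚ : ℚ
2ℚ = 1ℚ + 1ℚ

sgn : Bool → ℚ
sgn d = if d then 1ℚ else - 1ℚ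

ind : Bool → ℚ
ind b = if b then 1ℚ else 0ℚ

if-then-0≡ind* : ∀ b a → (if b then a else 0ℚ) ≡ ind b * a
if-then-0≡ind* true  a = sym (ℚ.*-identityˡ a)
if-then-0≡ind* false a = sym (ℚ.*-zeroˡ a)

*-if-then-0 : ∀ a b {c} → a * (if b then c else 0ℚ) ≡ (if b then a * c else 0ℚ)
*-if-then-0 a true  = refl
*-if-then-0 a false = ℚ.*-zeroʳ a

≡⇔-≡0 : ∀ {a b : ℚ} → a ≡ b ⇔ b - a ≡ 0ℚ
≡⇔-≡0 {a} {b} = mk⇔ (λ { refl → ℚ.+-inverseʳ a }) λ b-a≡0 → begin
    a                 ≡⟨ solve 2 (λ a b → a := b :- (b :- a)) refl a b ⟩
    b - (b - a)       ≡⟨ cong (λ t → b - t) b-a≡0 ⟩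
    b - 0ℚ            ≡⟨ ℚ.+-identityʳ b ⟩
    b                 ∎
  where open ≡-Reasoning

nonneg-and-nonpos : ∀ {a} → 0ℚ ≤ a → 0ℚ ≤ - a → a ≡ 0ℚ
nonneg-and-nonpos {a} 0≤a 0≤-a = ℚ.≤-antisym a≤0 0≤a
  where
  a≤0 : a ≤ 0ℚ
  a≤0 = subst (_≤ 0ℚ) (solve 1 (λ a → :- (:- a) := a) refl a) (ℚ.neg-antimono-≤ 0≤-a)

∑ : List ℚ → ℚ
∑ = foldr _+_ 0ℚ

module _ {A : Set} where

  ∑-cong : {f g : A → ℚ} → (∀ a → f a ≡ g a) → ∀ xs → ∑ (map f xs) ≡ ∑ (map g xs)
  ∑-cong f≗g []       = refl
  ∑-cong f≗g (x ∷ xs) = cong₂ _+_ (f≗g x) (∑-cong f≗g xs)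

  ∑-cong-All : {f g : A → ℚ} {xs : List A} → All (λ a → f a ≡ g a) xs → ∑ (map f xs) ≡ ∑ (map g xs)
  ∑-cong-All []         = refl
  ∑-cong-All (eq ∷ eqs) = cong₂ _+_ eq (∑-cong-All eqs)

  ∑-map-0 : {f : A → ℚ} → (∀ a → f a ≡ 0ℚ) → ∀ xs → ∑ (map f xs) ≡ 0ℚ
  ∑-map-0 f≗0 []       = refl
  ∑-map-0 f≗0 (x ∷ xs) = trans (cong₂ _+_ (f≗0 x) (∑-map-0 f≗0 xs)) (ℚ.+-identityˡ 0ℚ)

  ∑-map-++ : (f : A → ℚ) (xs ys : List A) → ∑ (map f (xs ++ ys)) ≡ ∑ (map f xs) + ∑ (map f ys)
  ∑-map-++ f []       ys = sym (ℚ.+-identityˡ _)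
  ∑-map-++ f (x ∷ xs) ys = trans (cong (f x +_) (∑-map-++ f xs ys)) (sym (ℚ.+-assoc (f x) _ _))

  ∑-map-+ : (f g : A → ℚ) (xs : List A) → ∑ (map (λ a → f a + g a) xs) ≡ ∑ (map f xs) + ∑ (map g xs)
  ∑-map-+ f g []       = refl
  ∑-map-+ f g (x ∷ xs) = trans (cong (f x + g x +_) (∑-map-+ f g xs))
    (solve 4 (λ a b c d → (a :+ b) :+ (c :+ d) := (a :+ c) :+ (b :+ d)) refl (f x) (g x) _ _)

  ∑-map-*ˡ : (c : ℚ) (f : A → ℚ) (xs : List A) → ∑ (map (λ a → c * f a) xs) ≡ c * ∑ (map f xs)
  ∑-map-*ˡ c f []       = sym (ℚ.*-zeroʳ c)
  ∑-map-*ˡ c f (x ∷ xs) = trans (cong (c * f x +_) (∑-map-*ˡ c f xs)) (sym (ℚ.*-distribˡ-+ c (f x) _))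

  ∑-map-neg : (f : A → ℚ) (xs : List A) → ∑ (map (λ a → - f a) xs) ≡ - ∑ (map f xs)
  ∑-map-neg f []       = refl
  ∑-map-neg f (x ∷ xs) = trans (cong (- f x +_) (∑-map-neg f xs)) (sym (ℚ.neg-distrib-+ (f x) _))

  ∑-map-c-2* : (c : ℚ) (f : A → ℚ) (xs : List A) →
               ∑ (map (λ a → c - 2ℚ * f a) xs) ≡ ∑ (map (λ _ → c) xs) - 2ℚ * ∑ (map f xs)
  ∑-map-c-2* c f xs = trans (∑-map-+ (λ _ → c) _ xs)
    (cong (∑ (map (λ _ → c) xs) +_) (trans (∑-map-neg (λ a → 2ℚ * f a) xs) (cong -_ (∑-map-*ˡ 2ℚ f xs))))

  ∑-map-loop+rest : (f : A → ℚ) (xs : List A) (a : A) (ys : List A) (b : A) (zs : List A) →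
                    ∑ (map f (xs ++ a ∷ ys ++ b ∷ zs)) ≡ ∑ (map f (a ∷ ys)) + ∑ (map f (xs ++ b ∷ zs))
  ∑-map-loop+rest f xs a ys b zs
    rewrite ∑-map-++ f xs (a ∷ ys ++ b ∷ zs) | ∑-map-++ f ys (b ∷ zs) | ∑-map-++ f xs (b ∷ zs) =
    solve 5 (λ x y z p q → x :+ (p :+ (y :+ (q :+ z))) := (p :+ y) :+ (x :+ (q :+ z))) refl
      (∑ (map f xs)) (∑ (map f ys)) (∑ (map f zs)) (f a) (f b)

  ∑-map-inner+outer+pair : (f : A → ℚ) (xs : List A) (a : A) (ys : List A) (b : A) (zs : List A) →
                           ∑ (map f (xs ++ a ∷ ys ++ b ∷ zs)) ≡ ∑ (map f ys) + ∑ (map f (xs ++ zs)) + (f a + f b)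
  ∑-map-inner+outer+pair f xs a ys b zs
    rewrite ∑-map-++ f xs (a ∷ ys ++ b ∷ zs) | ∑-map-++ f ys (b ∷ zs) | ∑-map-++ f xs zs =
    solve 5 (λ x y z p q → x :+ (p :+ (y :+ (q :+ z))) := (y :+ (x :+ z)) :+ (p :+ q)) refl
      (∑ (map f xs)) (∑ (map f ys)) (∑ (map f zs)) (f a) (f b)

  length-<-++-∷ : (xs : List A) (y : A) (ys : List A) → length xs ℕ.< length (xs ++ y ∷ ys)
  length-<-++-∷ xs y ys = ℕₚ.≤-trans (s≤s (length-++-≤ˡ xs)) (ℕₚ.≤-reflexive (sym (length-++-sucʳ xs y ys)))

  length-++-monoʳ-< : (xs : List A) {ys zs : List A} → length ys ℕ.< length zs → length (xs ++ ys) ℕ.< length (xs ++ zs)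
  length-++-monoʳ-< []       lt = lt
  length-++-monoʳ-< (x ∷ xs) lt = s≤s (length-++-monoʳ-< xs lt)

module _ {A B : Set} where

  ∑-swap : (h : A → B → ℚ) (xs : List A) (ys : List B) →
           ∑ (map (λ a → ∑ (map (h a) ys)) xs) ≡ ∑ (map (λ b → ∑ (map (λ a → h a b) xs)) ys)
  ∑-swap h []       ys = sym (∑-map-0 (λ _ → refl) ys)
  ∑-swap h (x ∷ xs) ys = trans (cong (∑ (map (h x) ys) +_) (∑-swap h xs ys)) (sym (∑-map-+ (h x) _ ys))

∑-allFin-suc : ∀ n (h : Fin (ℕ.suc n) → ℚ) → ∑ (map h (allFin (ℕ.suc n))) ≡ h zero + ∑ (map (h ∘ suc) (allFin n))
∑-allFin-suc n h = cong (λ l → h zero + ∑ l) (trans (map-tabulate suc h) (sym (map-tabulate id (h ∘ suc))))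

δ : ∀ {n} → Fin n → (Fin n → ℚ) → Fin n → ℚ
δ f c e = if ⌊ f ≟ e ⌋ then c e else 0ℚ

∑-allFin-δ : ∀ {n} (f : Fin n) (c : Fin n → ℚ) → ∑ (map (δ f c) (allFin n)) ≡ c f
∑-allFin-δ {ℕ.suc n} zero c =
  trans (∑-allFin-suc n (δ zero c)) (trans (cong (c zero +_) (∑-map-0 (λ _ → refl) (allFin n))) (ℚ.+-identityʳ (c zero)))
∑-allFin-δ {ℕ.suc n} (suc f) c = begin
    ∑ (map (δ (suc f) c) (allFin (ℕ.suc n)))             ≡⟨ ∑-allFin-suc n (δ (suc f) c) ⟩
    0ℚ + ∑ (map (δ (suc f) c ∘ suc) (allFin n))          ≡⟨ ℚ.+-identityˡ _ ⟩
    ∑ (map (δ (suc f) c ∘ suc) (allFin n))               ≡⟨ ∑-cong δ-suc (allFin n) ⟩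
    ∑ (map (δ f (c ∘ suc)) (allFin n))                   ≡⟨ ∑-allFin-δ f (c ∘ suc) ⟩
    c (suc f)                                            ∎
  where
  open ≡-Reasoning
  δ-suc : ∀ e → δ (suc f) c (suc e) ≡ δ f (c ∘ suc) e
  δ-suc e with f ≟ e
  ... | yes _ = refl
  ... | no _  = refl

module _ (G : Graph) where
  open Graph G

  infix 7 _·_
  _·_ : Vect G → Vect G → ℚ
  x · y = ⟨_,_⟩ G x y

  ·-cong : {x x′ y y′ : Vect G} → (∀ e → x e ≡ x′ e) → (∀ e → y e ≡ y′ e) → x · y ≡ x′ · y′
  ·-cong x≗x′ y≗y′ = ∑-cong (λ e → cong₂ _*_ (x≗x′ e) (y≗y′ e)) (allFin nE)

  val-sgn : ∀ y o → val G y o ≡ sgn (proj₂ o) * y (proj₁ o)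
  val-sgn y (e , true)  = sym (ℚ.*-identityˡ (y e))
  val-sgn y (e , false) = solve 1 (λ a → :- a := (:- con 1ℚ) :* a) refl (y e)

  val-cong : {y z : Vect G} → (∀ e → y e ≡ z e) → ∀ o → val G y o ≡ val G z o
  val-cong y≗z (e , true)  = y≗z e
  val-cong y≗z (e , false) = cong -_ (y≗z e)

  val-rev : ∀ y o → val G y (rev G o) ≡ - val G y o
  val-rev y (e , true)  = refl
  val-rev y (e , false) = solve 1 (λ a → a := :- (:- a)) refl (y e)

  tail-rev : ∀ o → tail G (rev G o) ≡ head G o
  tail-rev (e , true)  = refl
  tail-rev (e , false) = refl

  head-rev : ∀ o → head G (rev G o) ≡ tail G o
  head-rev (e , true)  = refl
  head-rev (e , false) = refl

  unit : OEdge G → Vect G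
  unit (f , d) e = if ⌊ f ≟ e ⌋ then sgn d else 0ℚ

  ·-unit : ∀ y o → y · unit o ≡ val G y o
  ·-unit y (f , d) = begin
    y · unit (f , d)                                    ≡⟨ ∑-cong (λ e → *-if-then-0 (y e) ⌊ f ≟ e ⌋) (allFin nE) ⟩
    ∑ (map (δ f (λ e → y e * sgn d)) (allFin nE))       ≡⟨ ∑-allFin-δ f (λ e → y e * sgn d) ⟩
    y f * sgn d                                         ≡⟨ ℚ.*-comm (y f) (sgn d) ⟩
    sgn d * y f                                         ≡⟨ val-sgn y (f , d) ⟨
    val G y (f , d)                                     ∎
    where open ≡-Reasoning

  chain : List (OEdge G) → Vect G
  chain W e = ∑ (map (λ o → unit o e) W)

  ·-chain : ∀ y W → y · chain W ≡ ∑ (map (val G y) W)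
  ·-chain y W = begin
    ∑ (map (λ e → y e * ∑ (map (λ o → unit o e) W)) (allFin nE))   ≡⟨ ∑-cong (λ e → ∑-map-*ˡ (y e) (λ o → unit o e) W) (allFin nE) ⟨
    ∑ (map (λ e → ∑ (map (λ o → y e * unit o e) W)) (allFin nE))   ≡⟨ ∑-swap (λ e o → y e * unit o e) (allFin nE) W ⟩
    ∑ (map (λ o → y · unit o) W)                                    ≡⟨ ∑-cong (·-unit y) W ⟩
    ∑ (map (val G y) W)                                             ∎
    where open ≡-Reasoning

  circuitEdges : Circuit G → List (OEdge G)
  circuitEdges C = tabulate (Circuit.es C)

  xC≗chain : ∀ C e → xC G C e ≡ chain (circuitEdges C) e
  xC≗chain C e = cong ∑ (trans (map-∘ (allFin _)) (cong (map (λ o → unit o e)) (map-tabulate id (Circuit.es C))))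

  data Walk : Fin nV → Fin nV → List (OEdge G) → Set where
    nil  : ∀ {u} → Walk u u []
    step : ∀ {u w o W} → tail G o ≡ u → Walk (head G o) w W → Walk u w (o ∷ W)

  subst-start : ∀ {u u′ w W} → u ≡ u′ → Walk u w W → Walk u′ w W
  subst-start refl p = p

  subst-end : ∀ {u w w′ W} → w ≡ w′ → Walk u w W → Walk u w′ W
  subst-end refl p = p

  _++ʷ_ : ∀ {u m w A B} → Walk u m A → Walk m w B → Walk u w (A ++ B)
  nil         ++ʷ q = q
  step t≡u p  ++ʷ q = step t≡u (p ++ʷ q)

  splitʷ : ∀ A {u w B} → Walk u w (A ++ B) → Σ[ m ∈ Fin nV ] (Walk u m A × Walk m w B)
  splitʷ []      p          = _ , nil , p
  splitʷ (o ∷ A) (step t≡u p) with splitʷ A p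
  ... | m , p₁ , p₂ = m , step t≡u p₁ , p₂

  coboundary : Fin nV → Vect G
  coboundary v e = ind ⌊ src e ≟ v ⌋ - ind ⌊ tgt e ≟ v ⌋

  ∑-allOEdges : (h : OEdge G → ℚ) (es : List (Fin nE)) →
                ∑ (map h (concatMap (λ e → (e , true) ∷ (e , false) ∷ []) es)) ≡ ∑ (map (λ e → h (e , true) + h (e , false)) es)
  ∑-allOEdges h []       = refl
  ∑-allOEdges h (e ∷ es) = trans (cong (λ t → h (e , true) + (h (e , false) + t)) (∑-allOEdges h es))
                                 (sym (ℚ.+-assoc (h (e , true)) (h (e , false)) _))

  outflow≡coboundary· : ∀ y v →
    ∑ (map (λ o → if ⌊ tail G o ≟ v ⌋ then val G y o else 0ℚ) (allOEdges G)) ≡ coboundary v · y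
  outflow≡coboundary· y v = trans (∑-allOEdges _ (allFin nE)) (∑-cong at-edge (allFin nE))
    where
    at-edge : ∀ e → (if ⌊ src e ≟ v ⌋ then y e else 0ℚ) + (if ⌊ tgt e ≟ v ⌋ then - y e else 0ℚ) ≡ coboundary v e * y e
    at-edge e = trans (cong₂ _+_ (if-then-0≡ind* ⌊ src e ≟ v ⌋ (y e)) (if-then-0≡ind* ⌊ tgt e ≟ v ⌋ (- y e)))
      (solve 3 (λ s t a → s :* a :+ t :* (:- a) := (s :- t) :* a) refl (ind ⌊ src e ≟ v ⌋) (ind ⌊ tgt e ≟ v ⌋) (y e))

  val-coboundary : ∀ v o → val G (coboundary v) o ≡ ind ⌊ tail G o ≟ v ⌋ - ind ⌊ head G o ≟ v ⌋
  val-coboundary v (e , true)  = refl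
  val-coboundary v (e , false) = solve 2 (λ a b → :- (a :- b) := b :- a) refl (ind ⌊ src e ≟ v ⌋) (ind ⌊ tgt e ≟ v ⌋)

  ∑-coboundary-walk : ∀ v {u w W} → Walk u w W → ∑ (map (val G (coboundary v)) W) ≡ ind ⌊ u ≟ v ⌋ - ind ⌊ w ≟ v ⌋
  ∑-coboundary-walk v {u} nil = sym (ℚ.+-inverseʳ (ind ⌊ u ≟ v ⌋))
  ∑-coboundary-walk v {w = w} (step {o = o} refl p) rewrite ∑-coboundary-walk v p | val-coboundary v o =
    solve 3 (λ a b c → (a :- b) :+ (b :- c) := a :- c) refl (ind ⌊ tail G o ≟ v ⌋) (ind ⌊ head G o ≟ v ⌋) (ind ⌊ w ≟ v ⌋)

  chain-closedWalk-isFlow : ∀ {u W} → Walk u u W → IsFlow G (chain W)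
  chain-closedWalk-isFlow {u} {W} p v = begin
    _                                       ≡⟨ outflow≡coboundary· (chain W) v ⟩
    coboundary v · chain W                  ≡⟨ ·-chain (coboundary v) W ⟩
    ∑ (map (val G (coboundary v)) W)        ≡⟨ ∑-coboundary-walk v p ⟩
    ind ⌊ u ≟ v ⌋ - ind ⌊ u ≟ v ⌋           ≡⟨ ℚ.+-inverseʳ (ind ⌊ u ≟ v ⌋) ⟩
    0ℚ                                      ∎
    where open ≡-Reasoning

  EdgeDistinct : List (OEdge G) → Set
  EdgeDistinct = AllPairs (λ a b → proj₁ a ≢ proj₁ b)

  unit-≢ : ∀ {e} b → proj₁ b ≢ e → unit b e ≡ 0ℚ
  unit-≢ {e} (f , d) f≢e with f ≟ e
  ... | yes f≡e = ⊥-elim (f≢e f≡e)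
  ... | no _    = refl

  unit-self : ∀ b → unit b (proj₁ b) ≡ sgn (proj₂ b)
  unit-self (f , d) with f ≟ f
  ... | yes _   = refl
  ... | no f≢f  = ⊥-elim (f≢f refl)

  chain-∉ : ∀ {e W} → All (λ b → proj₁ b ≢ e) W → chain W e ≡ 0ℚ
  chain-∉ []                 = refl
  chain-∉ {W = b ∷ _} (b≢ ∷ bs≢) = trans (cong₂ _+_ (unit-≢ b b≢) (chain-∉ bs≢)) (ℚ.+-identityˡ 0ℚ)

  chain-∈ : ∀ {W} → EdgeDistinct W → ∀ {o} → o ∈ W → chain W (proj₁ o) ≡ sgn (proj₂ o)
  chain-∈ {b ∷ W} (b≢ ∷ _) (here refl) =
    trans (cong₂ _+_ (unit-self b) (chain-∉ (All.map (_∘ sym) b≢))) (ℚ.+-identityʳ (sgn (proj₂ b)))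
  chain-∈ {b ∷ W} (b≢ ∷ W-distinct) (there o∈W) =
    trans (cong₂ _+_ (unit-≢ b (All.lookup b≢ o∈W)) (chain-∈ W-distinct o∈W)) (ℚ.+-identityˡ _)

  chain-integral : ∀ {W} → EdgeDistinct W → IsIntegral G (chain W)
  chain-integral {W} W-distinct e with any? (λ b → proj₁ b ≟ e) W
  ... | yes hit with find hit
  ...   | b , b∈W , refl = sgn-integral (proj₂ b) (chain-∈ W-distinct b∈W)
    where
    sgn-integral : ∀ d {a} → a ≡ sgn d → ∃ λ z → a ≡ z / 1
    sgn-integral true  a≡1  = ℤ.+ 1 , a≡1
    sgn-integral false a≡-1 = ℤ.-[1+ 0 ] , a≡-1
  chain-integral {W} W-distinct e | no miss = ℤ.+ 0 , chain-∉ (¬Any⇒All¬ W miss)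

  val-chain-∈ : ∀ {W} → EdgeDistinct W → ∀ {o} → o ∈ W → val G (chain W) o ≡ 1ℚ
  val-chain-∈ {W} W-distinct {f , d} o∈W =
    trans (val-sgn (chain W) (f , d)) (trans (cong (sgn d *_) (chain-∈ W-distinct o∈W)) (sgn² d))
    where
    sgn² : ∀ d → sgn d * sgn d ≡ 1ℚ
    sgn² true  = refl
    sgn² false = refl

  q-chain : ∀ {W} → EdgeDistinct W → q G (chain W) ≡ ∑ (map (λ _ → 1ℚ) W)
  q-chain {W} W-distinct = trans (·-chain (chain W) W) (∑-cong-All (All.tabulate (val-chain-∈ W-distinct)))

  supp-chain⊆ : ∀ {W} → EdgeDistinct W → ∀ {o} → 0ℚ < val G (chain W) o → o ∈ W
  supp-chain⊆ {W} W-distinct {f , d} 0<val with any? (λ b → proj₁ b ≟ f) W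
  ... | no miss = ⊥-elim (ℚ.<-irrefl refl (subst (0ℚ <_) val≡0 0<val))
    where
    val≡0 : val G (chain W) (f , d) ≡ 0ℚ
    val≡0 = trans (val-sgn (chain W) (f , d)) (trans (cong (sgn d *_) (chain-∉ (¬Any⇒All¬ W miss))) (ℚ.*-zeroʳ (sgn d)))
  ... | yes hit with find hit
  ...   | (.f , d′) , b∈W , refl with d′ Bool.≟ d
  ...     | yes refl = b∈W
  ...     | no d′≢d  = ⊥-elim (ℚ.<-asym 0<val (subst (_< 0ℚ) (sym val≡-1) (ℚ.negative⁻¹ (- 1ℚ))))
    where
    sgn-opposite : ∀ d d′ → d′ ≢ d → sgn d * sgn d′ ≡ - 1ℚ
    sgn-opposite true  true  d′≢d = ⊥-elim (d′≢d refl)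
    sgn-opposite true  false _    = refl
    sgn-opposite false true  _    = refl
    sgn-opposite false false d′≢d = ⊥-elim (d′≢d refl)
    val≡-1 : val G (chain W) (f , d) ≡ - 1ℚ
    val≡-1 = trans (val-sgn (chain W) (f , d)) (trans (cong (sgn d *_) (chain-∈ W-distinct b∈W)) (sgn-opposite d d′ d′≢d))

  q-− : ∀ x μ → q G (_−ᵥ_ G x μ) ≡ q G x + (q G μ - 2ℚ * (x · μ))
  q-− x μ = begin
    ∑ (map (λ e → (x e - μ e) * (x e - μ e)) (allFin nE))
      ≡⟨ ∑-cong (λ e → solve 2 (λ a b → (a :- b) :* (a :- b) := a :* a :+ (b :* b :- (con 1ℚ :+ con 1ℚ) :* (a :* b))) refl (x e) (μ e)) (allFin nE) ⟩
    ∑ (map (λ e → x e * x e + (μ e * μ e - 2ℚ * (x e * μ e))) (allFin nE))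
      ≡⟨ ∑-map-+ (λ e → x e * x e) _ (allFin nE) ⟩
    q G x + ∑ (map (λ e → μ e * μ e - 2ℚ * (x e * μ e)) (allFin nE))
      ≡⟨ cong (q G x +_) (∑-map-+ (λ e → μ e * μ e) _ (allFin nE)) ⟩
    q G x + (q G μ + ∑ (map (λ e → - (2ℚ * (x e * μ e))) (allFin nE)))
      ≡⟨ cong (λ t → q G x + (q G μ + t)) (trans (∑-map-neg _ (allFin nE)) (cong -_ (∑-map-*ˡ 2ℚ _ (allFin nE)))) ⟩
    q G x + (q G μ - 2ℚ * (x · μ))
      ∎
    where open ≡-Reasoning

  voronoi-inequality : ∀ {x μ} → InVO G x → InΛ G μ → 0ℚ ≤ q G μ - 2ℚ * (x · μ)
  voronoi-inequality {x} {μ} (_ , nearest) μ∈Λ =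
    subst₂ _≤_ (ℚ.+-inverseˡ (q G x)) (solve 2 (λ a t → (:- a) :+ (a :+ t) := t) refl (q G x) _)
      (ℚ.+-monoʳ-≤ (- q G x) (subst (q G x ≤_) (q-− x μ) (nearest μ μ∈Λ)))

  slack : Vect G → OEdge G → ℚ
  slack x o = 1ℚ - 2ℚ * val G x o

  walkSlack : Vect G → List (OEdge G) → ℚ
  walkSlack x W = ∑ (map (slack x) W)

  slack-rev : ∀ x o → slack x o + slack x (rev G o) ≡ 2ℚ
  slack-rev x o rewrite val-rev x o =
    solve 1 (λ v → (con 1ℚ :- (con 1ℚ :+ con 1ℚ) :* v) :+ (con 1ℚ :- (con 1ℚ :+ con 1ℚ) :* (:- v)) := con 1ℚ :+ con 1ℚ) refl (val G x o)

  walkSlack-chain : ∀ x {W} → EdgeDistinct W → walkSlack x W ≡ q G (chain W) - 2ℚ * (x · chain W)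
  walkSlack-chain x {W} W-distinct rewrite q-chain W-distinct | ·-chain x W = ∑-map-c-2* 1ℚ (val G x) W

  walkSlack-edgeDistinct-closed-nonneg : ∀ {x} → InVO G x → ∀ {u W} → EdgeDistinct W → Walk u u W → 0ℚ ≤ walkSlack x W
  walkSlack-edgeDistinct-closed-nonneg {x} x∈VO {W = W} W-distinct p =
    subst (0ℚ ≤_) (sym (walkSlack-chain x W-distinct))
      (voronoi-inequality x∈VO (chain-closedWalk-isFlow p , chain-integral W-distinct))

  Clash : OEdge G → OEdge G → Set
  Clash a b = tail G a ≡ tail G b ⊎ b ≡ rev G a

  clash? : ∀ a b → Dec (Clash a b)
  clash? a b with tail G a ≟ tail G b | ≡-dec _≟_ Bool._≟_ b (rev G a)
  ... | yes same-tail | _            = yes (inj₁ same-tail)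
  ... | no _          | yes reversed = yes (inj₂ reversed)
  ... | no ¬same-tail | no ¬reversed = no λ { (inj₁ same-tail) → ¬same-tail same-tail ; (inj₂ reversed) → ¬reversed reversed }

  ¬Clash⇒edge≢ : ∀ a b → ¬ Clash a b → proj₁ a ≢ proj₁ b
  ¬Clash⇒edge≢ (e , true)  (.e , true)  ¬clash refl = ¬clash (inj₁ refl)
  ¬Clash⇒edge≢ (e , true)  (.e , false) ¬clash refl = ¬clash (inj₂ refl)
  ¬Clash⇒edge≢ (e , false) (.e , true)  ¬clash refl = ¬clash (inj₂ refl)
  ¬Clash⇒edge≢ (e , false) (.e , false) ¬clash refl = ¬clash (inj₁ refl)

  data ClashSplit : List (OEdge G) → Set where
    clash : ∀ A o B o′ C → Clash o o′ → ClashSplit (A ++ o ∷ B ++ o′ ∷ C)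

  clashSplit? : ∀ W → ClashSplit W ⊎ AllPairs (λ a b → ¬ Clash a b) W
  clashSplit? [] = inj₂ []
  clashSplit? (a ∷ W) with any? (clash? a) W
  ... | yes hit with find hit
  ...   | o′ , o′∈W , a-clash with ∈-∃++ o′∈W
  ...     | B , C , refl = inj₁ (clash [] a B o′ C a-clash)
  clashSplit? (a ∷ W) | no miss with clashSplit? W
  ...   | inj₁ (clash A o B o′ C c) = inj₁ (clash (a ∷ A) o B o′ C c)
  ...   | inj₂ clash-free           = inj₂ (¬Any⇒All¬ W miss ∷ clash-free)

  clashFree⇒edgeDistinct : ∀ {W} → AllPairs (λ a b → ¬ Clash a b) W → EdgeDistinct W
  clashFree⇒edgeDistinct = AllPairs.map (λ {a} {b} → ¬Clash⇒edge≢ a b)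

  closedWalk-split-loop : ∀ {u} A o B o′ C → tail G o ≡ tail G o′ → Walk u u (A ++ o ∷ B ++ o′ ∷ C) →
                          Walk (tail G o) (tail G o) (o ∷ B) × Walk u u (A ++ o′ ∷ C)
  closedWalk-split-loop A o B o′ C same-tail p with splitʷ A p
  ... | m , pA , step o-from-m rest with splitʷ B rest
  ...   | m′ , pB , step o′-from-m′ pC =
    step refl (subst-end (trans (sym o′-from-m′) (sym same-tail)) pB) ,
    pA ++ʷ step (trans (sym same-tail) o-from-m) pC

  closedWalk-split-backtrack : ∀ {u} A o B o′ C → o′ ≡ rev G o → Walk u u (A ++ o ∷ B ++ o′ ∷ C) →
                               Walk (head G o) (head G o) B × Walk u u (A ++ C)
  closedWalk-split-backtrack A o B o′ C refl p with splitʷ A p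
  ... | m , pA , step o-from-m rest with splitʷ B rest
  ...   | m′ , pB , step o′-from-m′ pC =
    subst-end (trans (sym o′-from-m′) (tail-rev o)) pB ,
    pA ++ʷ subst-start (trans (head-rev o) o-from-m) pC

  walkSlack-closed-nonneg : ∀ {x} → InVO G x → ∀ {u} W → Walk u u W → 0ℚ ≤ walkSlack x W
  walkSlack-closed-nonneg {x} x∈VO W p = go W p (<-wellFounded (length W))
    where
    go : ∀ {u} W → Walk u u W → Acc ℕ._<_ (length W) → 0ℚ ≤ walkSlack x W
    go W p (acc smaller) with clashSplit? W
    ... | inj₂ clash-free = walkSlack-edgeDistinct-closed-nonneg x∈VO (clashFree⇒edgeDistinct clash-free) p
    ... | inj₁ (clash A o B o′ C (inj₁ same-tail)) with closedWalk-split-loop A o B o′ C same-tail p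
    ...   | loop , rest =
      subst (0ℚ ≤_) (sym (∑-map-loop+rest (slack x) A o B o′ C))
        (ℚ.+-mono-≤ (go (o ∷ B) loop (smaller loop-shorter)) (go (A ++ o′ ∷ C) rest (smaller rest-shorter)))
      where
      loop-shorter : length (o ∷ B) ℕ.< length (A ++ o ∷ B ++ o′ ∷ C)
      loop-shorter = ℕₚ.<-≤-trans (s≤s (length-<-++-∷ B o′ C)) (length-++-≤ʳ (o ∷ B ++ o′ ∷ C) {A})
      rest-shorter : length (A ++ o′ ∷ C) ℕ.< length (A ++ o ∷ B ++ o′ ∷ C)
      rest-shorter = length-++-monoʳ-< A (s≤s (length-++-≤ʳ (o′ ∷ C) {B}))
    go W p (acc smaller) | inj₁ (clash A o B o′ C (inj₂ reversed)) with closedWalk-split-backtrack A o B o′ C reversed p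
    ...   | inner , outer =
      subst (0ℚ ≤_) (sym (∑-map-inner+outer+pair (slack x) A o B o′ C))
        (ℚ.+-mono-≤ (ℚ.+-mono-≤ (go B inner (smaller inner-shorter)) (go (A ++ C) outer (smaller outer-shorter)))
                    (subst (0ℚ ≤_) (sym pair-slack) (ℚ.nonNegative⁻¹ 2ℚ)))
      where
      pair-slack : slack x o + slack x o′ ≡ 2ℚ
      pair-slack = trans (cong (λ t → slack x o + slack x t) reversed) (slack-rev x o)
      inner-shorter : length B ℕ.< length (A ++ o ∷ B ++ o′ ∷ C)
      inner-shorter = ℕₚ.<-≤-trans (length-<-++-∷ B o′ C) (ℕₚ.≤-trans (ℕₚ.n≤1+n _) (length-++-≤ʳ (o ∷ B ++ o′ ∷ C) {A}))
      outer-shorter : length (A ++ C) ℕ.< length (A ++ o ∷ B ++ o′ ∷ C)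
      outer-shorter = length-++-monoʳ-< A (s≤s (ℕₚ.≤-trans (ℕₚ.n≤1+n _) (length-++-≤ʳ (o′ ∷ C) {B})))

  circuit-closedWalk : ∀ C → let t = tail G (Circuit.es C zero) in Walk t t (circuitEdges C)
  circuit-closedWalk C = subst-end (Circuit.closes C) (path (Circuit.k C) (Circuit.es C) (Circuit.linked C))
    where
    path : ∀ n (f : Fin (ℕ.suc n) → OEdge G) → (∀ (i : Fin n) → head G (f (Data.Fin.inject₁ i)) ≡ tail G (f (suc i))) →
           Walk (tail G (f zero)) (head G (f (Data.Fin.fromℕ n))) (tabulate f)
    path ℕ.zero    f linked = step refl nil
    path (ℕ.suc n) f linked = step refl (subst-start (sym (linked zero)) (path n (f ∘ suc) (linked ∘ suc)))

  circuit-edgeDistinct : ∀ C → EdgeDistinct (circuitEdges C)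
  circuit-edgeDistinct C = AllPairs.tabulate⁺ {f = Circuit.es C} (λ i≢j same-edge → i≢j (Circuit.edgesDistinct C same-edge))

  walkSlack-circuit : ∀ x C → walkSlack x (circuitEdges C) ≡ q G (xC G C) - 2ℚ * (x · xC G C)
  walkSlack-circuit x C = trans (walkSlack-chain x (circuit-edgeDistinct C))
    (sym (cong₂ (λ a b → a - 2ℚ * b) (·-cong (xC≗chain C) (xC≗chain C)) (·-cong {x} (λ _ → refl) (xC≗chain C))))

  InH⇔tight : ∀ x C → InH G (xC G C) x ⇔ walkSlack x (circuitEdges C) ≡ 0ℚ
  InH⇔tight x C = subst (λ s → InH G (xC G C) x ⇔ s ≡ 0ℚ) (sym (walkSlack-circuit x C)) ≡⇔-≡0

  circuitEdges⇔supp : ∀ C {o} → o ∈ circuitEdges C ⇔ InSupp G (xC G C) o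
  circuitEdges⇔supp C {o} = mk⇔
    (λ o∈C → subst (0ℚ <_) (sym (trans (val-cong (xC≗chain C) o) (val-chain-∈ (circuit-edgeDistinct C) o∈C))) (ℚ.positive⁻¹ 1ℚ))
    (λ o∈supp → supp-chain⊆ (circuit-edgeDistinct C) (subst (0ℚ <_) (val-cong (xC≗chain C) o) o∈supp))

  ReturnPath : (OEdge G → ℚ) → OEdge G → Set
  ReturnPath f o = Σ[ R ∈ List (OEdge G) ] Walk (head G o) (tail G o) R × ∑ (map f R) ≡ - f o

  closedWalk-returnPath : ∀ f {u W} → Walk u u W → ∑ (map f W) ≡ 0ℚ → ∀ {o} → o ∈ W → ReturnPath f o
  closedWalk-returnPath f p ∑W≡0 {o} o∈W with ∈-∃++ o∈W
  ... | P , Q , refl with splitʷ P p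
  ...   | m , pP , step o-from-m pQ = Q ++ P , subst-end (sym o-from-m) (pQ ++ʷ pP) , ∑QP≡
    where
    open ≡-Reasoning
    ∑QP≡ : ∑ (map f (Q ++ P)) ≡ - f o
    ∑QP≡ = begin
      ∑ (map f (Q ++ P))                            ≡⟨ ∑-map-++ f Q P ⟩
      ∑ (map f Q) + ∑ (map f P)                     ≡⟨ solve 3 (λ p q c → q :+ p := (:- c) :+ (p :+ (c :+ q))) refl (∑ (map f P)) (∑ (map f Q)) (f o) ⟩
      - f o + (∑ (map f P) + (f o + ∑ (map f Q)))   ≡⟨ cong (- f o +_) (trans (sym (∑-map-++ f P (o ∷ Q))) ∑W≡0) ⟩
      - f o + 0ℚ                                    ≡⟨ ℚ.+-identityʳ (- f o) ⟩
      - f o                                         ∎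

  reverseWalk : ∀ f {a b A} → Walk a b A → All (ReturnPath f) A →
                Σ[ R ∈ List (OEdge G) ] Walk b a R × ∑ (map f R) ≡ - ∑ (map f A)
  reverseWalk f nil [] = [] , nil , refl
  reverseWalk f {A = o ∷ A} (step o-from-a p) ((P , pP , ∑P≡) ∷ returns) with reverseWalk f p returns
  ... | R , pR , ∑R≡ = R ++ P , subst-end o-from-a (pR ++ʷ pP) ,
    trans (∑-map-++ f R P) (trans (cong₂ _+_ ∑R≡ ∑P≡) (solve 2 (λ a s → (:- s) :+ (:- a) := :- (a :+ s)) refl (f o) (∑ (map f A))))

  face⊆VO : ∀ {F} → IsFace G F → ∀ {x} → F x → InVO G x
  face⊆VO (_ , _ , _ , F-spec) {x} Fx = proj₁ (proj₁ (F-spec x) Fx)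

  supp⊆φ⇒InU : ∀ {F} → IsFace G F → ∀ C → (∀ o → InSupp G (xC G C) o → Inφ G F o) → InU G F C
  supp⊆φ⇒InU face C supp⊆φ x Fx =
    Equivalence.from (InH⇔tight x C) (nonneg-and-nonpos C-nonneg (subst (0ℚ ≤_) ∑R≡ R-nonneg))
    where
    x∈VO = face⊆VO face Fx
    returnPath : ∀ {o} → o ∈ circuitEdges C → ReturnPath (slack x) o
    returnPath {o} o∈C with supp⊆φ o (Equivalence.to (circuitEdges⇔supp C {o}) o∈C)
    ... | D , D∈U , o∈suppD = closedWalk-returnPath (slack x) (circuit-closedWalk D)
      (Equivalence.to (InH⇔tight x D) (D∈U x Fx)) (Equivalence.from (circuitEdges⇔supp D {o}) o∈suppD)
    C-nonneg : 0ℚ ≤ walkSlack x (circuitEdges C)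
    C-nonneg = walkSlack-closed-nonneg x∈VO (circuitEdges C) (circuit-closedWalk C)
    reversed = reverseWalk (slack x) (circuit-closedWalk C) (All.tabulate returnPath)
    R = proj₁ reversed
    ∑R≡ = proj₂ (proj₂ reversed)
    R-nonneg : 0ℚ ≤ walkSlack x R
    R-nonneg = walkSlack-closed-nonneg x∈VO R (proj₁ (proj₂ reversed))

lemma2p5 : (G : Graph) → Connected G →
           (F : Vect G → Set) → IsFace G F →
           (C : Circuit G) →
           InU G F C ⇔ (∀ o → InSupp G (xC G C) o → Inφ G F o)
lemma2p5 G _ F face C = mk⇔ (λ C∈U o o∈supp → C , C∈U , o∈supp) (supp⊆φ⇒InU G face C)
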